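{- Let $\ell\ge1$, $\sigma=(1\ 2\ \cdots\ \ell+1)\in\mathfrak{S}_{\ell+1}$, $k\in\{1,\dots,\ell+1\}$, $g=\gcd\{\ell+1,k\}$ and $d=(\ell+1)/g$. Then $$\#\{\tau\in\mathfrak{S}_{\ell+1}:\tau\sigma^k\tau^{ -1}\in\langle\sigma\rangle\}=\varphi_g(\ell+1)\cdot(\ell+1)(\ell+1-d)(\ell+1-2d)\cdots(\ell+1-d(g-1)).$$
   Context: $\langle\sigma\rangle$ is the cyclic subgroup generated by $\sigma$. $\varphi_g(\ell+1)=\#\{i\in\{1,\dots,\ell+1\}:\gcd\{\ell+1,i\}=g\}$. -}

module Defs where

open import Data.Nat using (ℕ; zero; suc; _+_; _*_; _∸_)
open import Data.Nat.DivMod using (_%_; m%n<n)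
open import Data.Nat.GCD using (gcd)
open import Data.Fin using (Fin; toℕ; fromℕ<) renaming (zero to fzero)
open import Data.Fin.Properties using (any?; all?) renaming (_≟_ to _≟ᶠ_)
open import Data.Vec using (Vec; []; _∷_; lookup)
open import Data.List using (List; []; _∷_; map; concatMap; length; filter; upTo; allFin)
open import Data.Nat.ListAction using (product)
open import Data.List using () renaming ([_] to [_]ˡ)
open import Data.Fin using () renaming (_≟_ to _≟F_)
open import Data.Product using (∃; _,_)
open import Relation.Nullary using (Dec; yes; no; ¬_)
open import Relation.Nullary.Decidable using (_→-dec_)
open import Relation.Binary.PropositionalEquality using (_≡_)
import Data.Nat as ℕ

-- all functions Fin m → Fin n, represented as vectors (lookup gives the function)
allVecs : (n m : ℕ) → List (Vec (Fin n) m)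
allVecs n zero = [ [] ]ˡ
allVecs n (suc m) = concatMap (λ x → map (x ∷_) (allVecs n m)) (allFin n)

-- a vector τ : Vec (Fin n) n is a permutation of Fin n iff i ↦ lookup τ i is injective
-- (injective self-maps of a finite set are bijective)
IsPerm : ∀ {n} → Vec (Fin n) n → Set
IsPerm {n} τ = ∀ (i j : Fin n) → lookup τ i ≡ lookup τ j → i ≡ j

isPerm? : ∀ {n} (τ : Vec (Fin n) n) → Dec (IsPerm τ)
isPerm? τ = all? (λ i → all? (λ j → (lookup τ i ≟ᶠ lookup τ j) →-dec (i ≟ᶠ j)))

Sym : (n : ℕ) → List (Vec (Fin n) n)
Sym n = filter isPerm? (allVecs n n)

-- inverse of a permutation (search for the preimage; default only reached for non-permutations)
inv : ∀ {ℓ} → Vec (Fin (suc ℓ)) (suc ℓ) → Fin (suc ℓ) → Fin (suc ℓ)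
inv τ y with any? (λ i → lookup τ i ≟ᶠ y)
... | yes (i , _) = i
... | no _ = fzero

-- the (ℓ+1)-cycle σ = (1 2 ⋯ ℓ+1) on Fin (ℓ+1) (points 0..ℓ): i ↦ i+1 mod (ℓ+1)
σ : ∀ {ℓ} → Fin (suc ℓ) → Fin (suc ℓ)
σ {ℓ} i = fromℕ< (m%n<n (suc (toℕ i)) (suc ℓ))

pow : ∀ {A : Set} → (A → A) → ℕ → A → A
pow f zero x = x
pow f (suc k) x = f (pow f k x)

conj : ∀ {ℓ} → Vec (Fin (suc ℓ)) (suc ℓ) → ℕ → Fin (suc ℓ) → Fin (suc ℓ)
conj τ k i = lookup τ (pow σ k (inv τ i))

-- π ∈ ⟨σ⟩ : π = σ^j for some j; since σ has order ℓ+1, j ranges over 0..ℓ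
InCyclic : ∀ {ℓ} → (Fin (suc ℓ) → Fin (suc ℓ)) → Set
InCyclic {ℓ} π = ∃ λ (j : Fin (suc ℓ)) → ∀ i → π i ≡ pow σ (toℕ j) i

inCyclic? : ∀ {ℓ} (π : Fin (suc ℓ) → Fin (suc ℓ)) → Dec (InCyclic π)
inCyclic? π = any? (λ j → all? (λ i → π i ≟ᶠ pow σ (toℕ j) i))

countConj : (ℓ k : ℕ) → ℕ
countConj ℓ k = length (filter (λ τ → inCyclic? (conj τ k)) (Sym (suc ℓ)))

φ : ℕ → ℕ → ℕ
φ g N = length (filter (λ i → gcd N i ℕ.≟ g) (map suc (upTo N)))

stepProd : (N d g : ℕ) → ℕ
stepProd N d g = product (map (λ t → N ∸ d * t) (upTo g))

-- Write N = ℓ + 1. The permutation τ σᵏ τ⁻¹ lies in ⟨σ⟩ iff τ σᵏ = σʲ τ for some j < N, and this j is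
-- unique. Conjugate elements have the same order, so such τ exist only if gcd (N, j) = gcd (N, k) = g.
-- In that case the orbits of σᵏ and of σʲ are the residue classes mod g, and τ is determined by its
-- values at 0, …, g - 1 through τ (r + m k) = τ r + m j; these values can be any points of pairwise
-- distinct residue classes. Splitting Fin N ≅ Fin g × Fin d into residue and quotient, the choices are an
-- injection Fin g → Fin g and an arbitrary vector in (Fin d)ᵍ: g! dᵍ = N (N - d) ⋯ (N - (g - 1) d) of them
-- for each of the φ_g (N) admissible j.
module Submission where

open import Defs
open import Data.Nat using (ℕ; suc; _*_; _≤_)
open import Data.Nat.GCD using (gcd)
open import Relation.Binary.PropositionalEquality using (_≡_)

open import Data.Bool.Properties using (T-irrelevant)
open import Data.Empty using (⊥; ⊥-elim)
open import Data.Fin as Fin using (Fin; toℕ; fromℕ<; punchIn; punchOut) renaming (zero to fzero; suc to fsuc)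
import Data.Fin.Properties as Finₚ
open Finₚ using (cantor-schröder-bernstein; *↔×; all?)
open import Data.List as List using (List; []; _∷_; _++_; length; filter; upTo)
open import Data.List.Membership.Propositional using (_∈_)
open import Data.List.Membership.Propositional.Properties
  using (∈-lookup; ∈-map⁺; ∈-map⁻; ∈-concat⁺′; ∈-allFin; ∈-filter⁺; ∈-filter⁻; ∈-upTo⁺; ∈-upTo⁻)
open import Data.List.Properties using (upTo-∷ʳ; map-++)
open import Data.List.Relation.Binary.Disjoint.Propositional using (Disjoint)
open import Data.List.Relation.Unary.All as All using (All)
import Data.List.Relation.Unary.All.Properties as AllP
open import Data.List.Relation.Unary.AllPairs as AllPairs using (AllPairs; []; _∷_)
import Data.List.Relation.Unary.AllPairs.Properties as AllPairsP
open import Data.List.Relation.Unary.Any using (here; index)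
open import Data.List.Relation.Unary.Any.Properties using (lookup-index)
open import Data.List.Relation.Unary.Unique.Propositional using (Unique)
import Data.List.Relation.Unary.Unique.Propositional.Properties as Unique
open import Data.Nat as ℕ using (zero; _+_; _∸_; _^_; _<_; NonZero)
open import Data.Nat.Combinatorics.Base using (_P′_)
open import Data.Nat.Divisibility using (_∣_; divides; ∣-antisym; m%n≡0⇒n∣m; ∣⇒≤; ∣n⇒∣m*n; n∣m*n; ∣m+n∣m⇒∣n)
open import Data.Nat.DivMod
  using (_%_; _/_; m%n<n; m%n≤n; m≡m%n+[m/n]*n; [m+kn]%n≡m%n; %-distribˡ-+; %-distribˡ-*; m%n*o≡m*o%[n*o];
         %-congʳ; m*n%n≡0; m<n⇒m%n≡m; m%n%n≡m%n; m∣n⇒o%n%m≡o%m; %-remove-+ʳ; m<n*o⇒m/o<n; +-distrib-/-∣ʳ;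
         m<n⇒m/n≡0; m*n/n≡m)
open import Data.Nat.GCD using (gcd-GCD; module Bézout; gcd[m,n]∣m; gcd[m,n]∣n; gcd[m,n]≢0; gcd-greatest)
open import Data.Nat.ListAction using (product)
open import Data.Nat.ListAction.Properties using (product-++)
import Data.Nat.Properties as ℕₚ
open import Algebra.Properties.CommutativeSemigroup ℕₚ.*-commutativeSemigroup using (x∙yz≈y∙xz)
open import Data.Nat.Tactic.RingSolver using (solve-∀)
open import Data.Product using (Σ; ∃; _×_; _,_; proj₁; proj₂)
open import Data.Product.Algebra using (Σ-assoc)
open import Data.Product.Function.Dependent.Propositional using (Σ-↔)
open import Data.Product.Function.NonDependent.Propositional using (_×-↔_)
open import Data.Sum using (inj₁)
open import Data.Vec using (Vec; []; _∷_; lookup; tabulate)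
open import Data.Vec.Properties using (∷-injective; ∷-injectiveʳ; lookup∘tabulate; tabulate∘lookup; tabulate-cong)
open import Function using (_∘_)
open import Function.Bundles using (_↔_; mk↔ₛ′; Inverse; Injection)
open import Function.Properties.Inverse using (↔-sym; ↔-trans; ↔-refl; ↔⇒↣)
open import Relation.Binary.PropositionalEquality using (refl; sym; trans; cong; cong₂; subst; _≢_; module ≡-Reasoning)
open import Relation.Nullary using (Dec; yes; no)
open import Relation.Nullary.Decidable using (True; toWitness; fromWitness; _→-dec_; _×-dec_)
open import Relation.Nullary.Irrelevant using (Irrelevant)

Fin-↔⇒≡ : ∀ {m n} → Fin m ↔ Fin n → m ≡ n
Fin-↔⇒≡ e = cantor-schröder-bernstein (Injection.injective (↔⇒↣ e)) (Injection.injective (↔⇒↣ (↔-sym e)))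

Fin-cast : ∀ {m n} → m ≡ n → Fin m ↔ Fin n
Fin-cast refl = ↔-refl

Σ-≡ : ∀ {A : Set} {P : A → Set} → (∀ {a} → Irrelevant (P a)) →
      ∀ {a b} {p : P a} {q : P b} → a ≡ b → (a , p) ≡ (b , q)
Σ-≡ irr refl = cong (_ ,_) (irr _ _)

×-irrelevant : ∀ {A B : Set} → Irrelevant A → Irrelevant B → Irrelevant (A × B)
×-irrelevant irrA irrB (a , b) (a′ , b′) = cong₂ _,_ (irrA a a′) (irrB b b′)

module _ {A : Set} where

  lookup-injective : (xs : List A) → Unique xs → ∀ i j → List.lookup xs i ≡ List.lookup xs j → i ≡ j
  lookup-injective (x ∷ xs) u           fzero    fzero    e = refl
  lookup-injective (x ∷ xs) (x∉ ∷ u)    fzero    (fsuc j) e = ⊥-elim (All.lookup x∉ (∈-lookup j) e)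
  lookup-injective (x ∷ xs) (x∉ ∷ u)    (fsuc i) fzero    e = ⊥-elim (All.lookup x∉ (∈-lookup i) (sym e))
  lookup-injective (x ∷ xs) (_ ∷ u)     (fsuc i) (fsuc j) e = cong fsuc (lookup-injective xs u i j e)

  enumeration↔ : ∀ {P : A → Set} (xs : List A) → Unique xs →
                 (∀ {a} → a ∈ xs → P a) → (∀ {a} → P a → a ∈ xs) → (∀ {a} → Irrelevant (P a)) →
                 Fin (length xs) ↔ Σ A P
  enumeration↔ {P} xs unique sound complete irr = mk↔ₛ′ to from to∘from from∘to
    where
    to : Fin (length xs) → Σ A P
    to i = List.lookup xs i , sound (∈-lookup i)
    from : Σ A P → Fin (length xs)
    from (a , p) = index (complete p)
    to∘from : ∀ x → to (from x) ≡ x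
    to∘from (a , p) = Σ-≡ irr (sym (lookup-index (complete p)))
    from∘to : ∀ i → from (to i) ≡ i
    from∘to i = lookup-injective xs unique _ _ (sym (lookup-index (complete (sound (∈-lookup i)))))

allVecs-complete : ∀ n m (v : Vec (Fin n) m) → v ∈ allVecs n m
allVecs-complete n zero    []      = here refl
allVecs-complete n (suc m) (x ∷ v) =
  ∈-concat⁺′ (∈-map⁺ (x ∷_) (allVecs-complete n m v)) (∈-map⁺ _ (∈-allFin x))

allVecs-unique : ∀ n m → Unique (allVecs n m)
allVecs-unique n zero    = All.[] ∷ []
allVecs-unique n (suc m) = Unique.concat⁺ blocks-unique blocks-disjoint
  where
  block : Fin n → List (Vec (Fin n) (suc m))
  block x = List.map (x ∷_) (allVecs n m)
  blocks-unique : All Unique (List.map block (List.allFin n))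
  blocks-unique = AllP.map⁺ (All.universal (λ x → Unique.map⁺ ∷-injectiveʳ (allVecs-unique n m)) _)
  disjoint : ∀ {x y} → x ≢ y → Disjoint (block x) (block y)
  disjoint x≢y (p , q) with ∈-map⁻ _ p | ∈-map⁻ _ q
  ... | _ , _ , refl | _ , _ , e = x≢y (proj₁ (∷-injective e))
  blocks-disjoint : AllPairs Disjoint (List.map block (List.allFin n))
  blocks-disjoint = AllPairsP.map⁺ (AllPairs.map disjoint (Unique.allFin⁺ n))

Vec↔Fin^ : ∀ d t → Vec (Fin d) t ↔ Fin (d ^ t)
Vec↔Fin^ d zero    = mk↔ₛ′ (λ _ → fzero) (λ _ → []) (λ { fzero → refl ; (fsuc ()) }) (λ { [] → refl })
Vec↔Fin^ d (suc t) = ↔-trans uncons (↔-trans (↔-refl ×-↔ Vec↔Fin^ d t) (↔-sym *↔×))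
  where
  uncons : Vec (Fin d) (suc t) ↔ (Fin d × Vec (Fin d) t)
  uncons = mk↔ₛ′ (λ { (x ∷ w) → x , w }) (λ (x , w) → x ∷ w) (λ _ → refl) (λ { (x ∷ w) → refl })

-- Injective vectors and the falling factorial

IsInjective : ∀ {t n} → (Fin t → Fin n) → Set
IsInjective f = ∀ i j → f i ≡ f j → i ≡ j

isInjective? : ∀ {t n} (f : Fin t → Fin n) → Dec (IsInjective f)
isInjective? f = all? (λ i → all? (λ j → (f i Finₚ.≟ f j) →-dec (i Finₚ.≟ j)))

InjectiveVec : ℕ → ℕ → Set
InjectiveVec n t = Σ (Vec (Fin n) t) (λ v → True (isInjective? (lookup v)))

-- An injective x ∷ w is x followed by an injective vector in Fin (suc n) ∖ {x} ≅ Fin n.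
InjectiveVec-uncons : ∀ n t → InjectiveVec (suc n) (suc t) ↔ (Fin (suc n) × InjectiveVec n t)
InjectiveVec-uncons n t = mk↔ₛ′ to from to∘from from∘to
  where
  avoids : ∀ x (w : Vec (Fin (suc n)) t) → IsInjective (lookup (x ∷ w)) → ∀ a → x ≢ lookup w a
  avoids x w inj a e with () ← inj fzero (fsuc a) e

  remove : ∀ x w → IsInjective (lookup (x ∷ w)) → Vec (Fin n) t
  remove x w inj = tabulate (λ a → punchOut (avoids x w inj a))

  remove-injective : ∀ x w inj → IsInjective (lookup (remove x w inj))
  remove-injective x w inj a b e = Finₚ.suc-injective (inj (fsuc a) (fsuc b)
    (Finₚ.punchOut-injective (avoids x w inj a) (avoids x w inj b)
      (trans (sym (lookup∘tabulate _ a)) (trans e (lookup∘tabulate _ b)))))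

  insert : Fin (suc n) → Vec (Fin n) t → Vec (Fin (suc n)) t
  insert x w = tabulate (λ a → punchIn x (lookup w a))

  lookup-insert : ∀ x w a → lookup (insert x w) a ≡ punchIn x (lookup w a)
  lookup-insert x w = lookup∘tabulate _

  insert-injective : ∀ x w → IsInjective (lookup w) → IsInjective (lookup (x ∷ insert x w))
  insert-injective x w inj fzero    fzero    e = refl
  insert-injective x w inj fzero    (fsuc b) e = ⊥-elim (Finₚ.punchInᵢ≢i x _ (sym (trans e (lookup-insert x w b))))
  insert-injective x w inj (fsuc a) fzero    e = ⊥-elim (Finₚ.punchInᵢ≢i x _ (trans (sym (lookup-insert x w a)) e))
  insert-injective x w inj (fsuc a) (fsuc b) e = cong fsuc (inj a b (Finₚ.punchIn-injective x _ _
    (trans (sym (lookup-insert x w a)) (trans e (lookup-insert x w b)))))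

  to : InjectiveVec (suc n) (suc t) → Fin (suc n) × InjectiveVec n t
  to (x ∷ w , inj) = x , remove x w (toWitness inj) , fromWitness (remove-injective x w (toWitness inj))

  from : Fin (suc n) × InjectiveVec n t → InjectiveVec (suc n) (suc t)
  from (x , w , inj) = x ∷ insert x w , fromWitness (insert-injective x w (toWitness inj))

  to∘from : ∀ y → to (from y) ≡ y
  to∘from (x , w , _) = cong (x ,_) (Σ-≡ T-irrelevant (trans (tabulate-cong (λ a → removed a)) (tabulate∘lookup w)))
    where
    removed : ∀ a {x≢ : x ≢ lookup (insert x w) a} → punchOut x≢ ≡ lookup w a
    removed a = trans (Finₚ.punchOut-cong x (lookup-insert x w a)) (Finₚ.punchOut-punchIn x)

  from∘to : ∀ y → from (to y) ≡ y
  from∘to (x ∷ w , inj) = Σ-≡ T-irrelevant (cong (x ∷_) (trans (tabulate-cong inserted) (tabulate∘lookup w)))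
    where
    inserted : ∀ a → punchIn x (lookup (remove x w (toWitness inj)) a) ≡ lookup w a
    inserted a = trans (cong (punchIn x) (lookup∘tabulate _ a)) (Finₚ.punchIn-punchOut _)

IsInjective-≗ : ∀ {t n} {f h : Fin t → Fin n} → (∀ i → h i ≡ f i) → IsInjective f → IsInjective h
IsInjective-≗ h≗f f-inj i i′ eq = f-inj i i′ (trans (sym (h≗f i)) (trans eq (h≗f i′)))

module _ {C B : Set} {n t : ℕ} (e : C ↔ (Fin n × B)) where

  open Inverse e using () renaming (to to split; from to join)

  split-InjectiveVec : Σ (Vec C t) (λ w → True (isInjective? (proj₁ ∘ split ∘ lookup w))) ↔ (InjectiveVec n t × Vec B t)
  split-InjectiveVec = mk↔ₛ′ to from to∘from from∘to
    where
    firsts : Vec C t → Vec (Fin n) t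
    firsts w = tabulate (proj₁ ∘ split ∘ lookup w)
    seconds : Vec C t → Vec B t
    seconds w = tabulate (proj₂ ∘ split ∘ lookup w)
    zip : Vec (Fin n) t → Vec B t → Vec C t
    zip a b = tabulate (λ i → join (lookup a i , lookup b i))
    split-zip : ∀ a b i → split (lookup (zip a b) i) ≡ (lookup a i , lookup b i)
    split-zip a b i = trans (cong split (lookup∘tabulate _ i)) (Inverse.strictlyInverseˡ e _)

    to : Σ (Vec C t) (λ w → True (isInjective? (proj₁ ∘ split ∘ lookup w))) → InjectiveVec n t × Vec B t
    to (w , inj) = (firsts w , fromWitness (IsInjective-≗ (lookup∘tabulate _) (toWitness inj))) , seconds w
    from : InjectiveVec n t × Vec B t → Σ (Vec C t) (λ w → True (isInjective? (proj₁ ∘ split ∘ lookup w)))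
    from ((a , inj) , b) = zip a b , fromWitness (IsInjective-≗ (cong proj₁ ∘ split-zip a b) (toWitness inj))
    to∘from : ∀ x → to (from x) ≡ x
    to∘from ((a , _) , b) = cong₂ _,_
      (Σ-≡ T-irrelevant (trans (tabulate-cong (cong proj₁ ∘ split-zip a b)) (tabulate∘lookup a)))
      (trans (tabulate-cong (cong proj₂ ∘ split-zip a b)) (tabulate∘lookup b))
    from∘to : ∀ x → from (to x) ≡ x
    from∘to (w , _) = Σ-≡ T-irrelevant (trans (tabulate-cong join-split) (tabulate∘lookup w))
      where
      join-split : ∀ i → join (lookup (firsts w) i , lookup (seconds w) i) ≡ lookup w i
      join-split i = trans (cong₂ (λ p q → join (p , q)) (lookup∘tabulate _ i) (lookup∘tabulate _ i))
                           (Inverse.strictlyInverseʳ e _)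

P′-suc : ∀ n t → suc n P′ suc t ≡ suc n * (n P′ t)
P′-suc n zero    = refl
P′-suc n (suc t) = begin
  (n ∸ t) * (suc n P′ suc t)   ≡⟨ cong ((n ∸ t) *_) (P′-suc n t) ⟩
  (n ∸ t) * (suc n * (n P′ t)) ≡⟨ x∙yz≈y∙xz (n ∸ t) (suc n) (n P′ t) ⟩
  suc n * ((n ∸ t) * (n P′ t)) ∎
  where open ≡-Reasoning

InjectiveVec↔P′ : ∀ n t → InjectiveVec n t ↔ Fin (n P′ t)
InjectiveVec↔P′ n zero = mk↔ₛ′ (λ _ → fzero) (λ _ → [] , fromWitness {a? = isInjective? {n = n} (lookup [])} (λ ()))
  (λ { fzero → refl ; (fsuc ()) }) (λ { ([] , _) → cong ([] ,_) (T-irrelevant _ _) })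
InjectiveVec↔P′ zero (suc t) = ↔-trans (mk↔ₛ′ (λ { (() ∷ _ , _) }) (λ ()) (λ ()) (λ { (() ∷ _ , _) }))
  (Fin-cast (sym (cong (_* (zero P′ t)) (ℕₚ.0∸n≡0 t))))
InjectiveVec↔P′ (suc n) (suc t) = ↔-trans (InjectiveVec-uncons n t)
  (↔-trans (↔-refl ×-↔ InjectiveVec↔P′ n t) (↔-trans (↔-sym *↔×) (Fin-cast (sym (P′-suc n t)))))

stepProd≡P′*^ : ∀ d m t → stepProd (d * m) d t ≡ (m P′ t) * d ^ t
stepProd≡P′*^ d m zero    = refl
stepProd≡P′*^ d m (suc t) = begin
  product (List.map f (upTo (suc t)))            ≡⟨ cong (product ∘ List.map f) (upTo-∷ʳ t) ⟨
  product (List.map f (upTo t ++ t ∷ []))        ≡⟨ cong product (map-++ f (upTo t) (t ∷ [])) ⟩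
  product (List.map f (upTo t) ++ f t ∷ [])      ≡⟨ product-++ (List.map f (upTo t)) (f t ∷ []) ⟩
  stepProd (d * m) d t * (f t * 1)               ≡⟨ cong₂ (λ a b → a * (b * 1)) (stepProd≡P′*^ d m t) (sym (ℕₚ.*-distribˡ-∸ d m t)) ⟩
  (m P′ t) * d ^ t * (d * (m ∸ t) * 1)           ≡⟨ regroup (m P′ t) (d ^ t) d (m ∸ t) ⟩
  (m ∸ t) * (m P′ t) * (d * d ^ t)               ∎
  where
  open ≡-Reasoning
  f : ℕ → ℕ
  f s = d * m ∸ d * s
  regroup : ∀ p q d e → p * q * (d * e * 1) ≡ e * p * (d * q)
  regroup = solve-∀

-- Arithmetic modulo N

module _ {n : ℕ} .{{_ : NonZero n}} where

  %-cong-+ : ∀ {a b c e} → a % n ≡ b % n → c % n ≡ e % n → (a + c) % n ≡ (b + e) % n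
  %-cong-+ {a} {b} {c} {e} p q = begin
    (a + c) % n           ≡⟨ %-distribˡ-+ a c n ⟩
    (a % n + c % n) % n   ≡⟨ cong₂ (λ x y → (x + y) % n) p q ⟩
    (b % n + e % n) % n   ≡⟨ %-distribˡ-+ b e n ⟨
    (b + e) % n           ∎
    where open ≡-Reasoning

  %-cong-* : ∀ {a b c e} → a % n ≡ b % n → c % n ≡ e % n → (a * c) % n ≡ (b * e) % n
  %-cong-* {a} {b} {c} {e} p q = begin
    (a * c) % n             ≡⟨ %-distribˡ-* a c n ⟩
    (a % n * (c % n)) % n   ≡⟨ cong₂ (λ x y → (x * y) % n) p q ⟩
    (b % n * (e % n)) % n   ≡⟨ %-distribˡ-* b e n ⟨
    (b * e) % n             ∎
    where open ≡-Reasoning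

  %-cancel-+ˡ : ∀ a {b c} → (a + b) % n ≡ (a + c) % n → b % n ≡ c % n
  %-cancel-+ˡ a {b} {c} eq = begin
    b % n                   ≡⟨ add-complement b ⟨
    (a⁻ + (a + b)) % n      ≡⟨ %-cong-+ {a⁻} refl eq ⟩
    (a⁻ + (a + c)) % n      ≡⟨ add-complement c ⟩
    c % n                   ∎
    where
    open ≡-Reasoning
    a⁻ : ℕ
    a⁻ = n ∸ a % n
    add-complement : ∀ x → (a⁻ + (a + x)) % n ≡ x % n
    add-complement x = begin
      (a⁻ + (a + x)) % n                    ≡⟨ cong (λ t → (a⁻ + (t + x)) % n) (m≡m%n+[m/n]*n a n) ⟩
      (a⁻ + (a % n + a / n * n + x)) % n    ≡⟨ cong (_% n) (regroup a⁻ (a % n) (a / n * n) x) ⟩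
      (x + (a⁻ + a % n) + a / n * n) % n    ≡⟨ cong (λ t → (x + t + a / n * n) % n) (ℕₚ.m∸n+n≡m (m%n≤n a n)) ⟩
      (x + n + a / n * n) % n               ≡⟨ cong (_% n) (ℕₚ.+-assoc x n (a / n * n)) ⟩
      (x + suc (a / n) * n) % n             ≡⟨ [m+kn]%n≡m%n x (suc (a / n)) n ⟩
      x % n                                 ∎
      where
      regroup : ∀ c r s x → c + (r + s + x) ≡ x + (c + r) + s
      regroup = solve-∀

bezout : ∀ N a .{{_ : NonZero N}} → ∃ λ v → (v * a) % N ≡ gcd N a % N
bezout N a with Bézout.identity (gcd-GCD N a)
... | Bézout.-+ x y eq = y , (begin
  (y * a) % N          ≡⟨ cong (_% N) eq ⟨
  (G + x * N) % N      ≡⟨ [m+kn]%n≡m%n G x N ⟩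
  G % N                ∎)
  where
  open ≡-Reasoning
  G = gcd N a
bezout N@(suc n) a | Bézout.+- x y eq = n * y , (begin
  (n * y * a) % N              ≡⟨ [m+kn]%n≡m%n (n * y * a) G N ⟨
  (n * y * a + G * N) % N      ≡⟨ cong (_% N) (regroup₁ n y a G) ⟩
  (n * (G + y * a) + G) % N    ≡⟨ cong (λ z → (n * z + G) % N) eq ⟩
  (n * (x * N) + G) % N        ≡⟨ cong (_% N) (regroup₂ n x G) ⟩
  (G + n * x * N) % N          ≡⟨ [m+kn]%n≡m%n G (n * x) N ⟩
  G % N                        ∎)
  where
  open ≡-Reasoning
  G = gcd N a
  -- Here y * a ≡ -G, so n * y * a ≡ G modulo n + 1.
  regroup₁ : ∀ n y a G → n * y * a + G * suc n ≡ n * (G + y * a) + G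
  regroup₁ = solve-∀
  regroup₂ : ∀ n x G → n * (x * suc n) + G ≡ G + n * x * suc n
  regroup₂ = solve-∀

module _ {N : ℕ} .{{_ : NonZero N}} where

  mod-*-transfer : ∀ {a b} m m′ → gcd N a ∣ b → (m * a) % N ≡ (m′ * a) % N → (m * b) % N ≡ (m′ * b) % N
  mod-*-transfer {a} m m′ (divides c refl) eq = begin
    (m * (c * G)) % N     ≡⟨ cong (_% N) (regroup m c G) ⟩
    (m * G * c) % N       ≡⟨ %-cong-* (trans (times-gcd m) (trans (%-cong-* eq refl) (sym (times-gcd m′)))) refl ⟩
    (m′ * G * c) % N      ≡⟨ cong (_% N) (regroup m′ c G) ⟨
    (m′ * (c * G)) % N    ∎
    where
    open ≡-Reasoning
    G = gcd N a
    v = proj₁ (bezout N a)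
    regroup : ∀ m c G → m * (c * G) ≡ m * G * c
    regroup = solve-∀
    times-gcd : ∀ m → (m * G) % N ≡ (m * a * v) % N
    times-gcd m = begin
      (m * G) % N         ≡⟨ %-cong-* {a = m} refl (proj₂ (bezout N a)) ⟨
      (m * (v * a)) % N   ≡⟨ cong (_% N) (trans (x∙yz≈y∙xz m v a) (ℕₚ.*-comm v (m * a))) ⟩
      (m * a * v) % N     ∎

  mod-orbit : ∀ {a g} .{{_ : NonZero g}} → gcd N a ≡ g → ∀ x y → x % g ≡ y % g → ∃ λ m → (x + m * a) % N ≡ y % N
  mod-orbit {a} {g} gcd≡g x y x≡y = t * v , (begin
    (x + t * v * a) % N        ≡⟨ cong (λ z → (x + z) % N) (ℕₚ.*-assoc t v a) ⟩
    (x + t * (v * a)) % N      ≡⟨ %-cong-+ {a = x} refl (%-cong-* {a = t} refl va≡g) ⟩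
    (x + t * g) % N            ≡⟨ cong (_% N) x+tg≡y+pgN ⟩
    (y + x / g * g * N) % N    ≡⟨ [m+kn]%n≡m%n y (x / g * g) N ⟩
    y % N                      ∎)
    where
    open ≡-Reasoning
    v = proj₁ (bezout N a)
    va≡g : (v * a) % N ≡ g % N
    va≡g = trans (proj₂ (bezout N a)) (cong (_% N) gcd≡g)
    t = y / g + x / g * ℕ.pred N
    regroup : ∀ r p q n g → r + p * g + (q + p * n) * g ≡ r + q * g + p * g * suc n
    regroup = solve-∀
    x+tg≡y+pgN : x + t * g ≡ y + x / g * g * N
    x+tg≡y+pgN = begin
      x + t * g                                   ≡⟨ cong (_+ t * g) (m≡m%n+[m/n]*n x g) ⟩
      x % g + x / g * g + t * g                   ≡⟨ cong (λ r → r + x / g * g + t * g) x≡y ⟩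
      y % g + x / g * g + t * g                   ≡⟨ regroup (y % g) (x / g) (y / g) (ℕ.pred N) g ⟩
      y % g + y / g * g + x / g * g * suc (ℕ.pred N) ≡⟨ cong₂ (λ z n → z + x / g * g * n) (m≡m%n+[m/n]*n y g) (sym (ℕₚ.suc-pred N)) ⟨
      y + x / g * g * N                           ∎

  module _ {e f : ℕ} (e*f≡N : e * f ≡ N) where

    private instance
      e*f-nonZero : NonZero (e * f)
      e*f-nonZero = ℕ.≢-nonZero (λ e*f≡0 → ℕ.≢-nonZero⁻¹ N (trans (sym e*f≡N) e*f≡0))
      e-nonZero : NonZero e
      e-nonZero = ℕₚ.m*n≢0⇒m≢0 e
      f-nonZero : NonZero f
      f-nonZero = ℕₚ.m*n≢0⇒n≢0 e
      f*e-nonZero : NonZero (f * e)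
      f*e-nonZero = ℕₚ.m*n≢0 f e

    *-%≡0⇒∣ : ∀ a → (e * a) % N ≡ 0 → f ∣ a
    *-%≡0⇒∣ a ea≡0 = m%n≡0⇒n∣m a f (ℕₚ.m*n≡0⇒m≡0 (a % f) e (begin
      a % f * e            ≡⟨ m%n*o≡m*o%[n*o] a f e ⟩
      (a * e) % (f * e)    ≡⟨ cong (_% (f * e)) (ℕₚ.*-comm a e) ⟩
      (e * a) % (f * e)    ≡⟨ %-congʳ (trans (ℕₚ.*-comm f e) e*f≡N) ⟩
      (e * a) % N          ≡⟨ ea≡0 ⟩
      0                    ∎))
      where open ≡-Reasoning

    ∣⇒*-%≡0 : ∀ {a} → f ∣ a → (e * a) % N ≡ 0
    ∣⇒*-%≡0 (divides c refl) = trans (cong (_% N) (trans (x∙yz≈y∙xz e c f) (cong (c *_) e*f≡N))) (m*n%n≡0 c N)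

  gcd∣gcd-of-annihilators : ∀ {a b} → (∀ m → (m * a) % N ≡ 0 → (m * b) % N ≡ 0) → gcd N a ∣ gcd N b
  gcd∣gcd-of-annihilators {a} {b} ann =
    gcd-greatest G∣N (*-%≡0⇒∣ {D} {gcd N a} D*G≡N b (ann D (∣⇒*-%≡0 {D} {gcd N a} D*G≡N (gcd[m,n]∣n N a))))
    where
    G∣N = gcd[m,n]∣m N a
    D = _∣_.quotient G∣N
    D*G≡N : D * gcd N a ≡ N
    D*G≡N = sym (_∣_.equality G∣N)

-- Powers of σ and permutations of Fin N

pow-+ : ∀ {A : Set} (f : A → A) a b x → pow f (a + b) x ≡ pow f a (pow f b x)
pow-+ f zero    b x = refl
pow-+ f (suc a) b x = cong f (pow-+ f a b x)

module _ {ℓ : ℕ} where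

  private
    N = suc ℓ

  toℕ-pow-σ : ∀ m (x : Fin N) → toℕ (pow σ m x) ≡ (toℕ x + m) % N
  toℕ-pow-σ zero    x = sym (trans (cong (_% N) (ℕₚ.+-identityʳ (toℕ x))) (m<n⇒m%n≡m (Finₚ.toℕ<n x)))
  toℕ-pow-σ (suc m) x = begin
    toℕ (σ (pow σ m x))            ≡⟨ Finₚ.toℕ-fromℕ< _ ⟩
    suc (toℕ (pow σ m x)) % N      ≡⟨ cong (λ y → suc y % N) (toℕ-pow-σ m x) ⟩
    (1 + (toℕ x + m) % N) % N      ≡⟨ %-cong-+ {N} {1} {1} {(toℕ x + m) % N} {toℕ x + m} refl (m%n%n≡m%n (toℕ x + m) N) ⟩
    (1 + (toℕ x + m)) % N          ≡⟨ cong (_% N) (sym (ℕₚ.+-suc (toℕ x) m)) ⟩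
    (toℕ x + suc m) % N            ∎
    where open ≡-Reasoning

  pow-σ-cancel : ∀ m m′ (x : Fin N) → pow σ m x ≡ pow σ m′ x → m % N ≡ m′ % N
  pow-σ-cancel m m′ x eq =
    %-cancel-+ˡ {N} (toℕ x) (trans (sym (toℕ-pow-σ m x)) (trans (cong toℕ eq) (toℕ-pow-σ m′ x)))

  pow-σ-cong : ∀ m m′ (x : Fin N) → m % N ≡ m′ % N → pow σ m x ≡ pow σ m′ x
  pow-σ-cong m m′ x eq = Finₚ.toℕ-injective
    (trans (toℕ-pow-σ m x) (trans (%-cong-+ {N} {toℕ x} {toℕ x} {m} {m′} refl eq) (sym (toℕ-pow-σ m′ x))))

  pow-σ-transfer : ∀ {a b} m m′ → gcd N a ∣ b → ∀ {x y : Fin N} →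
                   pow σ (m * a) x ≡ pow σ (m′ * a) x → pow σ (m * b) y ≡ pow σ (m′ * b) y
  pow-σ-transfer {a} {b} m m′ G∣b {x} {y} eq =
    pow-σ-cong (m * b) (m′ * b) y (mod-*-transfer {N} {a} {b} m m′ G∣b (pow-σ-cancel (m * a) (m′ * a) x eq))

  pow-σ-orbit : ∀ {a g} .{{_ : NonZero g}} → gcd N a ≡ g → ∀ (x y : Fin N) →
                toℕ x % g ≡ toℕ y % g → ∃ λ m → pow σ (m * a) x ≡ y
  pow-σ-orbit {a} gcd≡g x y x≡y with m , eq ← mod-orbit {N} gcd≡g (toℕ x) (toℕ y) x≡y =
    m , Finₚ.toℕ-injective (trans (toℕ-pow-σ (m * a) x) (trans eq (m<n⇒m%n≡m (Finₚ.toℕ<n y))))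

  toℕ-pow-σ-% : ∀ {a g} .{{_ : NonZero g}} → g ∣ N → g ∣ a → ∀ (x : Fin N) → toℕ (pow σ a x) % g ≡ toℕ x % g
  toℕ-pow-σ-% {a} {g} g∣N g∣a x = begin
    toℕ (pow σ a x) % g   ≡⟨ cong (_% g) (toℕ-pow-σ a x) ⟩
    (toℕ x + a) % N % g   ≡⟨ m∣n⇒o%n%m≡o%m g N (toℕ x + a) g∣N ⟩
    (toℕ x + a) % g       ≡⟨ %-remove-+ʳ (toℕ x) g∣a ⟩
    toℕ x % g             ∎
    where open ≡-Reasoning

  inv-lookup : ∀ (τ : Vec (Fin N) N) → IsPerm τ → ∀ x → inv τ (lookup τ x) ≡ x
  inv-lookup τ τ-inj x with Finₚ.any? (λ i → lookup τ i Finₚ.≟ lookup τ x)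
  ... | yes (i , τi≡τx) = τ-inj i x τi≡τx
  ... | no ∄i          = ⊥-elim (∄i (x , refl))

  IsPerm⇒surjective : ∀ (τ : Vec (Fin N) N) → IsPerm τ → ∀ y → ∃ λ x → lookup τ x ≡ y
  IsPerm⇒surjective τ τ-inj y with Finₚ.any? (λ i → lookup τ i Finₚ.≟ y)
  ... | yes preimage = preimage
  ... | no ∄x with i , j , i<j , eq ← Finₚ.pigeonhole (ℕₚ.n<1+n ℓ) (λ x → punchOut (λ y≡τx → ∄x (x , sym y≡τx)))
    = ⊥-elim (ℕₚ.<⇒≢ i<j (cong toℕ (τ-inj i j (Finₚ.punchOut-injective {i = y} _ _ eq))))

-- Permutations τ with τ σᵏ = σʲ τ

Intertwines : ∀ {ℓ} → Vec (Fin (suc ℓ)) (suc ℓ) → ℕ → Fin (suc ℓ) → Set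
Intertwines τ k j = ∀ x → lookup τ (pow σ k x) ≡ pow σ (toℕ j) (lookup τ x)

intertwines? : ∀ {ℓ} (τ : Vec (Fin (suc ℓ)) (suc ℓ)) k j → Dec (Intertwines τ k j)
intertwines? τ k j = all? (λ x → lookup τ (pow σ k x) Finₚ.≟ pow σ (toℕ j) (lookup τ x))

Intertwiners : ∀ {ℓ} → ℕ → Fin (suc ℓ) → Set
Intertwiners {ℓ} k j = Σ (Vec (Fin (suc ℓ)) (suc ℓ)) (λ τ → True (isPerm? τ) × True (intertwines? τ k j))

module _ {ℓ : ℕ} {τ : Vec (Fin (suc ℓ)) (suc ℓ)} {k : ℕ} where

  private
    N = suc ℓ

  intertwines-pow : ∀ {j} → Intertwines τ k j → ∀ m x → lookup τ (pow σ (m * k) x) ≡ pow σ (m * toℕ j) (lookup τ x)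
  intertwines-pow τσ≡στ zero    x = refl
  intertwines-pow {j} τσ≡στ (suc m) x = begin
    lookup τ (pow σ (k + m * k) x)                 ≡⟨ cong (lookup τ) (pow-+ σ k (m * k) x) ⟩
    lookup τ (pow σ k (pow σ (m * k) x))           ≡⟨ τσ≡στ _ ⟩
    pow σ (toℕ j) (lookup τ (pow σ (m * k) x))     ≡⟨ cong (pow σ (toℕ j)) (intertwines-pow τσ≡στ m x) ⟩
    pow σ (toℕ j) (pow σ (m * toℕ j) (lookup τ x)) ≡⟨ pow-+ σ (toℕ j) (m * toℕ j) _ ⟨
    pow σ (toℕ j + m * toℕ j) (lookup τ x)         ∎
    where open ≡-Reasoning

  InCyclic-conj⇒Intertwines : IsPerm τ → (c : InCyclic (conj τ k)) → Intertwines τ k (proj₁ c)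
  InCyclic-conj⇒Intertwines τ-inj (j , conj≡σʲ) x =
    trans (cong (lookup τ ∘ pow σ k) (sym (inv-lookup τ τ-inj x))) (conj≡σʲ (lookup τ x))

  Intertwines⇒InCyclic-conj : ∀ {j} → IsPerm τ → Intertwines τ k j → InCyclic (conj τ k)
  Intertwines⇒InCyclic-conj {j} τ-inj τσ≡στ = j , conj≡σʲ
    where
    conj≡σʲ : ∀ y → conj τ k y ≡ pow σ (toℕ j) y
    conj≡σʲ y with x , refl ← IsPerm⇒surjective τ τ-inj y =
      trans (cong (lookup τ ∘ pow σ k) (inv-lookup τ τ-inj x)) (τσ≡στ x)

  Intertwines-unique : ∀ {j j′} → Intertwines τ k j → Intertwines τ k j′ → j ≡ j′
  Intertwines-unique {j} {j′} τσ≡σʲτ τσ≡σʲ′τ = Finₚ.toℕ-injective (begin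
    toℕ j       ≡⟨ m<n⇒m%n≡m (Finₚ.toℕ<n j) ⟨
    toℕ j % N   ≡⟨ pow-σ-cancel (toℕ j) (toℕ j′) (lookup τ fzero) (trans (sym (τσ≡σʲτ _)) (τσ≡σʲ′τ fzero)) ⟩
    toℕ j′ % N  ≡⟨ m<n⇒m%n≡m (Finₚ.toℕ<n j′) ⟩
    toℕ j′      ∎)
    where open ≡-Reasoning

  -- τ σᵏ τ⁻¹ = σʲ forces σᵏ and σʲ to have the same order, i.e. the same gcd with N.
  Intertwines⇒gcd≡ : ∀ {j} → IsPerm τ → Intertwines τ k j → gcd N (toℕ j) ≡ gcd N k
  Intertwines⇒gcd≡ {j} τ-inj τσ≡στ =
    ∣-antisym (gcd∣gcd-of-annihilators {N} j-ann⇒k-ann) (gcd∣gcd-of-annihilators {N} k-ann⇒j-ann)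
    where
    k-ann⇒j-ann : ∀ m → (m * k) % N ≡ 0 → (m * toℕ j) % N ≡ 0
    k-ann⇒j-ann m mk≡0 = pow-σ-cancel (m * toℕ j) 0 (lookup τ fzero)
      (trans (sym (intertwines-pow τσ≡στ m fzero)) (cong (lookup τ) (pow-σ-cong (m * k) 0 fzero mk≡0)))
    j-ann⇒k-ann : ∀ m → (m * toℕ j) % N ≡ 0 → (m * k) % N ≡ 0
    j-ann⇒k-ann m mj≡0 = pow-σ-cancel (m * k) 0 fzero
      (τ-inj _ _ (trans (intertwines-pow τσ≡στ m fzero) (pow-σ-cong (m * toℕ j) 0 (lookup τ fzero) mj≡0)))

module Fiber {ℓ k : ℕ} (j : Fin (suc ℓ)) {g : ℕ}
             (gcd[N,k]≡g : gcd (suc ℓ) k ≡ g) (gcd[N,j]≡g : gcd (suc ℓ) (toℕ j) ≡ g) where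

  private
    N = suc ℓ

  instance
    g-nonZero : NonZero g
    g-nonZero = ℕ.≢-nonZero (λ g≡0 → gcd[m,n]≢0 N k (inj₁ λ ()) (trans gcd[N,k]≡g g≡0))

  g∣N : g ∣ N
  g∣N = subst (_∣ N) gcd[N,k]≡g (gcd[m,n]∣m N k)

  g∣k : g ∣ k
  g∣k = subst (_∣ k) gcd[N,k]≡g (gcd[m,n]∣n N k)

  g∣j : g ∣ toℕ j
  g∣j = subst (_∣ toℕ j) gcd[N,j]≡g (gcd[m,n]∣n N (toℕ j))

  residue : Fin N → Fin g
  residue x = fromℕ< (m%n<n (toℕ x) g)

  toℕ-residue : ∀ x → toℕ (residue x) ≡ toℕ x % g
  toℕ-residue x = Finₚ.toℕ-fromℕ< _

  residue-≡⇒%-≡ : ∀ {x y} → residue x ≡ residue y → toℕ x % g ≡ toℕ y % g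
  residue-≡⇒%-≡ {x} {y} eq = trans (sym (toℕ-residue x)) (trans (cong toℕ eq) (toℕ-residue y))

  residue-pow-σ : ∀ {a} → g ∣ a → ∀ x → residue (pow σ a x) ≡ residue x
  residue-pow-σ g∣a x = Finₚ.toℕ-injective (trans (toℕ-residue _) (trans (toℕ-pow-σ-% g∣N g∣a x) (sym (toℕ-residue x))))

  rep : Fin g → Fin N
  rep r = Fin.inject≤ r (∣⇒≤ g∣N)

  residue-rep : ∀ r → residue (rep r) ≡ r
  residue-rep r = Finₚ.toℕ-injective (begin
    toℕ (residue (rep r))   ≡⟨ toℕ-residue (rep r) ⟩
    toℕ (rep r) % g         ≡⟨ cong (_% g) (Finₚ.toℕ-inject≤ r _) ⟩
    toℕ r % g               ≡⟨ m<n⇒m%n≡m (Finₚ.toℕ<n r) ⟩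
    toℕ r                   ∎)
    where open ≡-Reasoning

  steps : Fin N → ℕ
  steps x = proj₁ (pow-σ-orbit {a = k} gcd[N,k]≡g (rep (residue x)) x (residue-≡⇒%-≡ (residue-rep (residue x))))

  steps-spec : ∀ x → pow σ (steps x * k) (rep (residue x)) ≡ x
  steps-spec x = proj₂ (pow-σ-orbit {a = k} gcd[N,k]≡g (rep (residue x)) x (residue-≡⇒%-≡ (residue-rep (residue x))))

  k⇒j : ∀ m m′ {x y} → pow σ (m * k) x ≡ pow σ (m′ * k) x → pow σ (m * toℕ j) y ≡ pow σ (m′ * toℕ j) y
  k⇒j m m′ = pow-σ-transfer {a = k} {b = toℕ j} m m′ (subst (_∣ toℕ j) (sym gcd[N,k]≡g) g∣j)

  j⇒k : ∀ m m′ {x y} → pow σ (m * toℕ j) x ≡ pow σ (m′ * toℕ j) x → pow σ (m * k) y ≡ pow σ (m′ * k) y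
  j⇒k m m′ = pow-σ-transfer {a = toℕ j} {b = k} m m′ (subst (_∣ k) (sym gcd[N,j]≡g) g∣k)

  ResidueInjectiveVec : Set
  ResidueInjectiveVec = Σ (Vec (Fin N) g) (λ w → True (isInjective? (residue ∘ lookup w)))

  restrict : Vec (Fin N) N → Vec (Fin N) g
  restrict τ = tabulate (lookup τ ∘ rep)

  extend : Vec (Fin N) g → Vec (Fin N) N
  extend w = tabulate (λ x → pow σ (steps x * toℕ j) (lookup w (residue x)))

  lookup-extend : ∀ w x → lookup (extend w) x ≡ pow σ (steps x * toℕ j) (lookup w (residue x))
  lookup-extend w = lookup∘tabulate _

  restrict-extend : ∀ w → restrict (extend w) ≡ w
  restrict-extend w = trans (tabulate-cong extend-rep) (tabulate∘lookup w)
    where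
    extend-rep : ∀ r → lookup (extend w) (rep r) ≡ lookup w r
    extend-rep r = begin
      lookup (extend w) (rep r)                                  ≡⟨ lookup-extend w (rep r) ⟩
      pow σ (steps (rep r) * toℕ j) (lookup w (residue (rep r))) ≡⟨ k⇒j (steps (rep r)) 0 steps-fix ⟩
      lookup w (residue (rep r))                                 ≡⟨ cong (lookup w) (residue-rep r) ⟩
      lookup w r                                                 ∎
      where
      open ≡-Reasoning
      steps-fix : pow σ (steps (rep r) * k) (rep (residue (rep r))) ≡ rep (residue (rep r))
      steps-fix = trans (steps-spec (rep r)) (cong rep (sym (residue-rep r)))

  extend-restrict : ∀ τ → Intertwines τ k j → extend (restrict τ) ≡ τ
  extend-restrict τ τσ≡στ = trans (tabulate-cong extend-restrict-at) (tabulate∘lookup τ)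
    where
    extend-restrict-at : ∀ x → pow σ (steps x * toℕ j) (lookup (restrict τ) (residue x)) ≡ lookup τ x
    extend-restrict-at x = begin
      pow σ (steps x * toℕ j) (lookup (restrict τ) (residue x)) ≡⟨ cong (pow σ (steps x * toℕ j)) (lookup∘tabulate _ (residue x)) ⟩
      pow σ (steps x * toℕ j) (lookup τ (rep (residue x)))      ≡⟨ intertwines-pow {τ = τ} τσ≡στ (steps x) _ ⟨
      lookup τ (pow σ (steps x * k) (rep (residue x)))          ≡⟨ cong (lookup τ) (steps-spec x) ⟩
      lookup τ x                                                ∎
      where open ≡-Reasoning

  extend-intertwines : ∀ w → Intertwines (extend w) k j
  extend-intertwines w x = begin
    lookup (extend w) x′                                           ≡⟨ lookup-extend w x′ ⟩
    pow σ (steps x′ * toℕ j) (lookup w (residue x′))               ≡⟨ cong (pow σ (steps x′ * toℕ j) ∘ lookup w) same-residue ⟩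
    pow σ (steps x′ * toℕ j) (lookup w (residue x))                ≡⟨ k⇒j (steps x′) (suc (steps x)) one-more-step ⟩
    pow σ (toℕ j + steps x * toℕ j) (lookup w (residue x))         ≡⟨ pow-+ σ (toℕ j) (steps x * toℕ j) _ ⟩
    pow σ (toℕ j) (pow σ (steps x * toℕ j) (lookup w (residue x))) ≡⟨ cong (pow σ (toℕ j)) (lookup-extend w x) ⟨
    pow σ (toℕ j) (lookup (extend w) x)                            ∎
    where
    open ≡-Reasoning
    x′ = pow σ k x
    same-residue : residue x′ ≡ residue x
    same-residue = residue-pow-σ g∣k x
    one-more-step : pow σ (steps x′ * k) (rep (residue x)) ≡ pow σ (k + steps x * k) (rep (residue x))
    one-more-step = begin
      pow σ (steps x′ * k) (rep (residue x))          ≡⟨ cong (pow σ (steps x′ * k) ∘ rep) same-residue ⟨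
      pow σ (steps x′ * k) (rep (residue x′))         ≡⟨ steps-spec x′ ⟩
      pow σ k x                                       ≡⟨ cong (pow σ k) (steps-spec x) ⟨
      pow σ k (pow σ (steps x * k) (rep (residue x))) ≡⟨ pow-+ σ k (steps x * k) _ ⟨
      pow σ (k + steps x * k) (rep (residue x))       ∎

  extend-injective : ∀ w → IsInjective (residue ∘ lookup w) → IsPerm (extend w)
  extend-injective w w-inj x y eq = begin
    x                                             ≡⟨ steps-spec x ⟨
    pow σ (steps x * k) (rep (residue x))         ≡⟨ j⇒k (steps x) (steps y) same-image ⟩
    pow σ (steps y * k) (rep (residue x))         ≡⟨ cong (pow σ (steps y * k) ∘ rep) same-residue ⟩
    pow σ (steps y * k) (rep (residue y))         ≡⟨ steps-spec y ⟩
    y                                             ∎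
    where
    open ≡-Reasoning
    residue-extend : ∀ z → residue (lookup (extend w) z) ≡ residue (lookup w (residue z))
    residue-extend z = trans (cong residue (lookup-extend w z)) (residue-pow-σ (∣n⇒∣m*n (steps z) g∣j) _)
    same-residue : residue x ≡ residue y
    same-residue = w-inj _ _ (trans (sym (residue-extend x)) (trans (cong residue eq) (residue-extend y)))
    same-image : pow σ (steps x * toℕ j) (lookup w (residue x)) ≡ pow σ (steps y * toℕ j) (lookup w (residue x))
    same-image = begin
      pow σ (steps x * toℕ j) (lookup w (residue x)) ≡⟨ lookup-extend w x ⟨
      lookup (extend w) x                            ≡⟨ eq ⟩
      lookup (extend w) y                            ≡⟨ lookup-extend w y ⟩
      pow σ (steps y * toℕ j) (lookup w (residue y)) ≡⟨ cong (pow σ (steps y * toℕ j) ∘ lookup w) same-residue ⟨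
      pow σ (steps y * toℕ j) (lookup w (residue x)) ∎

  restrict-injective : ∀ τ → IsPerm τ → Intertwines τ k j → IsInjective (residue ∘ lookup (restrict τ))
  restrict-injective τ τ-inj τσ≡στ r s eq = begin
    r                                     ≡⟨ residue-rep r ⟨
    residue (rep r)                       ≡⟨ residue-pow-σ (∣n⇒∣m*n m g∣k) (rep r) ⟨
    residue (pow σ (m * k) (rep r))       ≡⟨ cong residue (τ-inj _ _ τσᵐᵏr≡τs) ⟩
    residue (rep s)                       ≡⟨ residue-rep s ⟩
    s                                     ∎
    where
    open ≡-Reasoning
    restrict-at : ∀ r → lookup (restrict τ) r ≡ lookup τ (rep r)
    restrict-at = lookup∘tabulate _
    orbit = pow-σ-orbit {a = toℕ j} gcd[N,j]≡g (lookup τ (rep r)) (lookup τ (rep s))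
      (residue-≡⇒%-≡ (trans (cong residue (sym (restrict-at r))) (trans eq (cong residue (restrict-at s)))))
    m = proj₁ orbit
    τσᵐᵏr≡τs : lookup τ (pow σ (m * k) (rep r)) ≡ lookup τ (rep s)
    τσᵐᵏr≡τs = trans (intertwines-pow {τ = τ} τσ≡στ m (rep r)) (proj₂ orbit)

  Intertwiners↔ResidueInjectiveVec : Intertwiners k j ↔ ResidueInjectiveVec
  Intertwiners↔ResidueInjectiveVec = mk↔ₛ′ to from to∘from from∘to
    where
    to : Intertwiners k j → ResidueInjectiveVec
    to (τ , perm , comm) = restrict τ , fromWitness (restrict-injective τ (toWitness perm) (toWitness comm))
    from : ResidueInjectiveVec → Intertwiners k j
    from (w , inj) = extend w , fromWitness (extend-injective w (toWitness inj)) , fromWitness (extend-intertwines w)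
    to∘from : ∀ w → to (from w) ≡ w
    to∘from (w , _) = Σ-≡ T-irrelevant (restrict-extend w)
    from∘to : ∀ τ → from (to τ) ≡ τ
    from∘to (τ , _ , comm) = Σ-≡ (×-irrelevant T-irrelevant T-irrelevant) (extend-restrict τ (toWitness comm))

  module _ {d : ℕ} (d*g≡N : d * g ≡ N) where

    quotient : Fin N → Fin d
    quotient x = fromℕ< (m<n*o⇒m/o<n (subst (toℕ x <_) (sym d*g≡N) (Finₚ.toℕ<n x)))

    toℕ-quotient : ∀ x → toℕ (quotient x) ≡ toℕ x / g
    toℕ-quotient x = Finₚ.toℕ-fromℕ< _

    combine : Fin g → Fin d → Fin N
    combine r q = fromℕ< (subst (toℕ r + toℕ q * g <_) d*g≡N (ℕₚ.<-≤-trans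
      (ℕₚ.+-monoˡ-< (toℕ q * g) (Finₚ.toℕ<n r)) (ℕₚ.*-monoˡ-≤ g (Finₚ.toℕ<n q))))

    toℕ-combine : ∀ r q → toℕ (combine r q) ≡ toℕ r + toℕ q * g
    toℕ-combine r q = Finₚ.toℕ-fromℕ< _

    residue-combine : ∀ r q → residue (combine r q) ≡ r
    residue-combine r q = Finₚ.toℕ-injective (begin
      toℕ (residue (combine r q))  ≡⟨ trans (toℕ-residue _) (cong (_% g) (toℕ-combine r q)) ⟩
      (toℕ r + toℕ q * g) % g      ≡⟨ [m+kn]%n≡m%n (toℕ r) (toℕ q) g ⟩
      toℕ r % g                    ≡⟨ m<n⇒m%n≡m (Finₚ.toℕ<n r) ⟩
      toℕ r                        ∎)
      where open ≡-Reasoning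

    quotient-combine : ∀ r q → quotient (combine r q) ≡ q
    quotient-combine r q = Finₚ.toℕ-injective (begin
      toℕ (quotient (combine r q))   ≡⟨ trans (toℕ-quotient _) (cong (_/ g) (toℕ-combine r q)) ⟩
      (toℕ r + toℕ q * g) / g        ≡⟨ +-distrib-/-∣ʳ (toℕ r) (n∣m*n (toℕ q)) ⟩
      toℕ r / g + toℕ q * g / g      ≡⟨ cong₂ _+_ (m<n⇒m/n≡0 (Finₚ.toℕ<n r)) (m*n/n≡m (toℕ q) g) ⟩
      toℕ q                          ∎)
      where open ≡-Reasoning

    combine-residue-quotient : ∀ x → combine (residue x) (quotient x) ≡ x
    combine-residue-quotient x = Finₚ.toℕ-injective (begin
      toℕ (combine (residue x) (quotient x))   ≡⟨ toℕ-combine (residue x) (quotient x) ⟩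
      toℕ (residue x) + toℕ (quotient x) * g   ≡⟨ cong₂ (λ r q → r + q * g) (toℕ-residue x) (toℕ-quotient x) ⟩
      toℕ x % g + toℕ x / g * g                ≡⟨ m≡m%n+[m/n]*n (toℕ x) g ⟨
      toℕ x                                    ∎)
      where open ≡-Reasoning

    residue-quotient↔ : Fin N ↔ (Fin g × Fin d)
    residue-quotient↔ = mk↔ₛ′ (λ x → residue x , quotient x) (λ (r , q) → combine r q)
      (λ (r , q) → cong₂ _,_ (residue-combine r q) (quotient-combine r q)) combine-residue-quotient

    Intertwiners↔stepProd : Intertwiners k j ↔ Fin (stepProd N d g)
    Intertwiners↔stepProd =
      ↔-trans Intertwiners↔ResidueInjectiveVec (
      ↔-trans (split-InjectiveVec residue-quotient↔) (
      ↔-trans (InjectiveVec↔P′ g g ×-↔ Vec↔Fin^ d g) (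
      ↔-trans (↔-sym *↔×)
              (Fin-cast (sym (trans (cong (λ M → stepProd M d g) (sym d*g≡N)) (stepProd≡P′*^ d g g)))))))

-- Residues with a given gcd

gcd∣gcd[m,m∸n] : ∀ {m n} → n ≤ m → gcd m n ∣ gcd m (m ∸ n)
gcd∣gcd[m,m∸n] {m} {n} n≤m = gcd-greatest (gcd[m,n]∣m m n)
  (∣m+n∣m⇒∣n (subst (gcd m n ∣_) (sym (ℕₚ.m+[n∸m]≡n n≤m)) (gcd[m,n]∣m m n)) (gcd[m,n]∣n m n))

gcd[m,m∸n]≡gcd[m,n] : ∀ {m n} → n ≤ m → gcd m (m ∸ n) ≡ gcd m n
gcd[m,m∸n]≡gcd[m,n] {m} {n} n≤m = ∣-antisym
  (subst (gcd m (m ∸ n) ∣_) (cong (gcd m) (ℕₚ.m∸[m∸n]≡n n≤m)) (gcd∣gcd[m,m∸n] (ℕₚ.m∸n≤m m n)))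
  (gcd∣gcd[m,m∸n] n≤m)

module _ (g N : ℕ) where

  φ-counts? : (i : ℕ) → Dec (1 ≤ i × i ≤ N × gcd N i ≡ g)
  φ-counts? i = (1 ℕ.≤? i) ×-dec (i ℕ.≤? N) ×-dec (gcd N i ℕ.≟ g)

  -- i ↦ N - i maps {1, …, N} onto {0, …, N - 1} and preserves gcd with N.
  φ↔ : Fin (φ g N) ↔ Σ (Fin N) (λ j → True (gcd N (toℕ j) ℕ.≟ g))
  φ↔ = ↔-trans (enumeration↔ candidates unique sound complete T-irrelevant) (mk↔ₛ′ to from to∘from from∘to)
    where
    gcd≟g = λ i → gcd N i ℕ.≟ g
    candidates = filter gcd≟g (List.map suc (upTo N))
    unique : Unique candidates
    unique = Unique.filter⁺ gcd≟g (Unique.map⁺ ℕₚ.suc-injective (Unique.upTo⁺ N))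
    sound : ∀ {i} → i ∈ candidates → True (φ-counts? i)
    sound i∈ with i∈suc[upTo] , gcd≡g ← ∈-filter⁻ gcd≟g {xs = List.map suc (upTo N)} i∈
            with b , b∈upTo , refl ← ∈-map⁻ suc i∈suc[upTo]
      = fromWitness (ℕ.s≤s ℕ.z≤n , ∈-upTo⁻ b∈upTo , gcd≡g)
    complete : ∀ {i} → True (φ-counts? i) → i ∈ candidates
    complete {i} p with toWitness p
    ... | ℕ.s≤s ℕ.z≤n , i≤N , gcd≡g = ∈-filter⁺ gcd≟g (∈-map⁺ suc (∈-upTo⁺ i≤N)) gcd≡g
    to : Σ ℕ (λ i → True (φ-counts? i)) → Σ (Fin N) (λ j → True (gcd N (toℕ j) ℕ.≟ g))
    to (i , p) with 1≤i , i≤N , gcd≡g ← toWitness p =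
      fromℕ< (ℕₚ.∸-monoʳ-< 1≤i i≤N) ,
      fromWitness (trans (cong (gcd N) (Finₚ.toℕ-fromℕ< _)) (trans (gcd[m,m∸n]≡gcd[m,n] i≤N) gcd≡g))
    from : Σ (Fin N) (λ j → True (gcd N (toℕ j) ℕ.≟ g)) → Σ ℕ (λ i → True (φ-counts? i))
    from (j , q) = N ∸ toℕ j , fromWitness (ℕₚ.m<n⇒0<n∸m (Finₚ.toℕ<n j) , ℕₚ.m∸n≤m N (toℕ j) ,
      trans (gcd[m,m∸n]≡gcd[m,n] (ℕₚ.<⇒≤ (Finₚ.toℕ<n j))) (toWitness q))
    to∘from : ∀ x → to (from x) ≡ x
    to∘from (j , _) = Σ-≡ T-irrelevant (Finₚ.toℕ-injective
      (trans (Finₚ.toℕ-fromℕ< _) (ℕₚ.m∸[m∸n]≡n (ℕₚ.<⇒≤ (Finₚ.toℕ<n j)))))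
    from∘to : ∀ x → from (to x) ≡ x
    from∘to (i , p) with 1≤i , i≤N , _ ← toWitness p =
      Σ-≡ T-irrelevant (trans (cong (N ∸_) (Finₚ.toℕ-fromℕ< (ℕₚ.∸-monoʳ-< 1≤i i≤N))) (ℕₚ.m∸[m∸n]≡n i≤N))

module _ (ℓ k : ℕ) where

  private
    N = suc ℓ

  Conjugators : Set
  Conjugators = Σ (Vec (Fin N) N) (λ τ → True (isPerm? τ) × True (inCyclic? (conj τ k)))

  countConj↔Conjugators : Fin (countConj ℓ k) ↔ Conjugators
  countConj↔Conjugators = enumeration↔ conjugators unique sound complete (×-irrelevant T-irrelevant T-irrelevant)
    where
    inCyclic-conj? = λ (τ : Vec (Fin N) N) → inCyclic? (conj τ k)
    conjugators = filter inCyclic-conj? (Sym N)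
    unique : Unique conjugators
    unique = Unique.filter⁺ inCyclic-conj? (Unique.filter⁺ isPerm? (allVecs-unique N N))
    sound : ∀ {τ} → τ ∈ conjugators → True (isPerm? τ) × True (inCyclic-conj? τ)
    sound τ∈ with τ∈Sym , inCyclic ← ∈-filter⁻ inCyclic-conj? {xs = Sym N} τ∈
             with _ , perm ← ∈-filter⁻ isPerm? {xs = allVecs N N} τ∈Sym
      = fromWitness perm , fromWitness inCyclic
    complete : ∀ {τ} → True (isPerm? τ) × True (inCyclic-conj? τ) → τ ∈ conjugators
    complete {τ} (perm , inCyclic) =
      ∈-filter⁺ inCyclic-conj? (∈-filter⁺ isPerm? (allVecs-complete N N τ) (toWitness perm)) (toWitness inCyclic)

  Conjugators↔ΣIntertwiners : Conjugators ↔ Σ (Fin N) (Intertwiners k)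
  Conjugators↔ΣIntertwiners = mk↔ₛ′ to from to∘from from∘to
    where
    to : Conjugators → Σ (Fin N) (Intertwiners k)
    to (τ , perm , inCyclic) = j , τ , perm ,
      fromWitness {a? = intertwines? τ k j} (InCyclic-conj⇒Intertwines {τ = τ} {k = k} (toWitness perm) σʲ)
      where
      σʲ = toWitness inCyclic
      j = proj₁ σʲ
    from : Σ (Fin N) (Intertwiners k) → Conjugators
    from (j , τ , perm , comm) = τ , perm ,
      fromWitness {a? = inCyclic? (conj τ k)} (Intertwines⇒InCyclic-conj {τ = τ} {k = k} {j = j} (toWitness perm) (toWitness comm))
    ≡-intertwiner : ∀ {j j′ τ} {p : True (isPerm? τ) × True (intertwines? τ k j)}
                    {p′ : True (isPerm? τ) × True (intertwines? τ k j′)} →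
                    j ≡ j′ → _≡_ {A = Σ (Fin N) (Intertwiners k)} (j , τ , p) (j′ , τ , p′)
    ≡-intertwiner {j} {τ = τ} refl = cong (λ p → j , τ , p) (×-irrelevant T-irrelevant T-irrelevant _ _)
    to∘from : ∀ x → to (from x) ≡ x
    to∘from x@(j , τ , perm , comm) = ≡-intertwiner
      (Intertwines-unique {τ = τ} {k = k} (InCyclic-conj⇒Intertwines {τ = τ} {k = k} (toWitness perm) σʲ) (toWitness comm))
      where
      σʲ = toWitness (proj₂ (proj₂ (from x)))
    from∘to : ∀ x → from (to x) ≡ x
    from∘to (τ , _) = cong (τ ,_) (×-irrelevant T-irrelevant T-irrelevant _ _)

  Intertwiners↔ : ∀ {g d} → g ≡ gcd N k → d * g ≡ N → ∀ j →
                  Intertwiners k j ↔ (True (gcd N (toℕ j) ℕ.≟ g) × Fin (stepProd N d g))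
  Intertwiners↔ {g} {d} g≡gcd d*g≡N j with gcd N (toℕ j) ℕ.≟ g
  ... | yes gcd[N,j]≡g = ↔-trans (Fiber.Intertwiners↔stepProd {k = k} j (sym g≡gcd) gcd[N,j]≡g {d} d*g≡N)
                          (mk↔ₛ′ (_ ,_) proj₂ (λ _ → refl) (λ _ → refl))
  ... | no gcd[N,j]≢g  = mk↔ₛ′ (⊥-elim ∘ wrong-gcd) (λ { (() , _) }) (λ { (() , _) }) (⊥-elim ∘ wrong-gcd)
    where
    wrong-gcd : Intertwiners k j → ⊥
    wrong-gcd (τ , perm , comm) =
      gcd[N,j]≢g (trans (Intertwines⇒gcd≡ {τ = τ} {k = k} {j = j} (toWitness perm) (toWitness comm)) (sym g≡gcd))

mainTheorem13 : (ℓ k g d : ℕ) → 1 ≤ ℓ → 1 ≤ k → k ≤ suc ℓ →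
    g ≡ gcd (suc ℓ) k → d * g ≡ suc ℓ →
    countConj ℓ k ≡ φ g (suc ℓ) * stepProd (suc ℓ) d g
mainTheorem13 ℓ k g d _ _ _ g≡gcd d*g≡N = Fin-↔⇒≡ (
  ↔-trans (countConj↔Conjugators ℓ k) (
  ↔-trans (Conjugators↔ΣIntertwiners ℓ k) (
  ↔-trans (Σ-↔ ↔-refl (λ {j} → Intertwiners↔ ℓ k {g} {d} g≡gcd d*g≡N j)) (
  ↔-trans (↔-sym Σ-assoc) (
  ↔-trans (↔-sym (φ↔ g (suc ℓ)) ×-↔ ↔-refl)
          (↔-sym *↔×))))))
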